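{- Let $G$ be a finite abelian group with identity $1$, let $S$ be an inverse-closed subset of $G\setminus\{1\}$ with $|S|\ge 3$, let $s\in S$ be such that $H=\langle S\setminus\{s,s^{ -1}\}\rangle \neq G$, and let $\Gamma=\mathrm{Cay}(G;S)$. If $\Gamma$ is distance-regular, then $[G:H]\le 4$. Moreover, if $[G:H]=4$, then the order of $s$ is $4$.
   Context: The Cayley graph $\mathrm{Cay}(G;S)$ has vertex set $G$, with $g$ adjacent to $h$ iff $h=gs'$ for some $s'\in S$. A connected graph is distance-regular if for each $i$ up to the diameter the numbers $|N_{i-1}(x)\cap N(y)|$, $|N_i(x)\cap N(y)|$, $|N_{i+1}(x)\cap N(y)|$ depend only on the distance $i$ between $x$ and $y$, where $N_j(x)$ is the set of vertices at distance $j$ from $x$ and $N(y)=N_1(y)$. -}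

module Defs where

open import Data.Nat using (ℕ; zero; suc; _<_; _≤_)
open import Data.Fin using (Fin)
open import Data.Fin.Subset using (Subset; _∈_)
open import Data.List using (List; length)
open import Data.List.Membership.Propositional using () renaming (_∈_ to _∈ˡ_)
open import Data.List.Relation.Unary.Unique.Propositional using (Unique)
open import Data.Product using (Σ; ∃; _×_; _,_)
open import Algebra.Core using (Op₁; Op₂)
open import Relation.Binary.PropositionalEquality using (_≡_; _≢_)
open import Relation.Nullary using (¬_)
open import Function.Bundles using (_⇔_)

-- A finite group is modelled on the carrier Fin n (every finite group is
-- isomorphic to one of this form), with operation _∙_, identity ε, inverse _⁻¹.
module GroupNotions {n : ℕ} (_∙_ : Op₂ (Fin n)) (ε : Fin n) (_⁻¹ : Op₁ (Fin n)) where

  pow : Fin n → ℕ → Fin n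
  pow g zero = ε
  pow g (suc k) = g ∙ pow g k

  HasOrder : Fin n → ℕ → Set
  HasOrder g m = (0 < m) × (pow g m ≡ ε) × (∀ k → 0 < k → pow g k ≡ ε → m ≤ k)

  data ⟨_⟩ (T : Fin n → Set) : Fin n → Set where
    gen  : ∀ {x} → T x → ⟨ T ⟩ x
    one  : ⟨ T ⟩ ε
    mul  : ∀ {x y} → ⟨ T ⟩ x → ⟨ T ⟩ y → ⟨ T ⟩ (x ∙ y)
    inv  : ∀ {x} → ⟨ T ⟩ x → ⟨ T ⟩ (x ⁻¹)

  -- [G : H] = k : there is a transversal of k elements for the left cosets of H,
  -- i.e. k cosets r_i H which cover G and are pairwise distinct.
  IndexIs : (Fin n → Set) → ℕ → Set
  IndexIs H k = Σ (Fin k → Fin n) λ r →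
    (∀ x → ∃ λ i → H ((r i ⁻¹) ∙ x)) ×
    (∀ i j → H ((r i ⁻¹) ∙ r j) → i ≡ j)

  module Cayley (S : Subset n) where

    Adj : Fin n → Fin n → Set
    Adj g h = ∃ λ t → (t ∈ S) × (h ≡ g ∙ t)

    data Walk : Fin n → Fin n → ℕ → Set where
      here : ∀ {x} → Walk x x zero
      step : ∀ {x y z k} → Adj x y → Walk y z k → Walk x z (suc k)

    Dist : Fin n → Fin n → ℕ → Set
    Dist x y d = Walk x y d × (∀ k → k < d → ¬ Walk x y k)

    Connected : Set
    Connected = ∀ x y → ∃ λ d → Dist x y d

    CountIs : (Fin n → Set) → ℕ → Set
    CountIs P m = Σ (List (Fin n)) λ zs → Unique zs × (length zs ≡ m) × (∀ z → (z ∈ˡ zs) ⇔ P z)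

    -- distance-regular: connected, and for x, y at distance i the numbers
    -- c_i = |N_{i-1}(x) ∩ N(y)|, a_i = |N_i(x) ∩ N(y)|, b_i = |N_{i+1}(x) ∩ N(y)|
    -- depend only on i.  (N_{-1}(x) = ∅, so c_0 = 0 is automatic and omitted.)
    DistanceRegular : Set
    DistanceRegular = Connected × Σ (ℕ → ℕ) λ c → Σ (ℕ → ℕ) λ a → Σ (ℕ → ℕ) λ b →
      (∀ x y j → Dist x y (suc j) → CountIs (λ z → Dist x z j × Adj y z) (c (suc j))) ×
      (∀ x y i → Dist x y i → CountIs (λ z → Dist x z i × Adj y z) (a i)) ×
      (∀ x y i → Dist x y i → CountIs (λ z → Dist x z (suc i) × Adj y z) (b i))

module Submission where

-- Proof idea.  Write T = S ∖ {s, s⁻¹} and H = ⟨T⟩, so that every element of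
-- S is s, s⁻¹ or an element of H.
--
-- (1) Index bound.  Walking in Cay(G;S) from 1 and multiplying by generators
--     only moves between the cosets sⁱH, and Γ is connected, so these cosets
--     cover G.  Hence if sⁱ ∈ H for some i > 0, the cosets s⁰H, …, sⁱ⁻¹H
--     already cover G and [G : H] ≤ i.
-- (2) Obstruction.  Suppose s, s², s³ ∉ H and s⁴ ≠ 1, and pick t ∈ T (there
--     is one since |S| ≥ 3).  Then s² and st are both at distance 2 from 1,
--     but s is the only common neighbour of 1 and s², while s and t are two
--     common neighbours of 1 and st; so c₂ is not well defined and Γ is not
--     distance-regular.
-- (3) If [G : H] ≥ 4, then by (1) none of s, s², s³ lies in H, so by (2)
--     s⁴ = 1, and then (1) gives [G : H] ≤ 4, and s has order exactly 4.

open import Defs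
open import Data.Nat using (ℕ; zero; suc; _+_; _*_; _≤_; _<_; z≤n; s≤s; _≤?_; NonZero)
open import Data.Nat.Properties using (≤-trans; ≤-refl; ≤-reflexive; <⇒≤; <⇒≱; ≰⇒>; 1+n≰n; n≤1+n; +-suc; +-monoʳ-≤)
open import Data.Nat.DivMod using (_%_; _/_; m≡m%n+[m/n]*n; m%n<n)
open import Data.Fin using (Fin; fromℕ<; _≟_)
open import Data.Fin.Properties using (injective⇒≤; fromℕ<-injective; any?)
open import Data.Fin.Subset using (Subset; _∈_; _∉_; ∣_∣; ⁅_⁆; _∪_; inside; outside)
open import Data.Fin.Subset.Properties using (_∈?_; p⊆q⇒∣p∣≤∣q∣; x∈⁅x⁆; x∈p∪q⁺; ∣⁅x⁆∣≡1)
open import Data.Vec as Vec using ()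
open import Data.Product using (∃; _×_; _,_; proj₁; proj₂)
open import Data.Sum using (_⊎_; inj₁; inj₂)
open import Data.Empty using (⊥; ⊥-elim)
open import Data.List using (List; []; _∷_; length)
open import Data.List.Relation.Unary.Any using (here; there)
open import Data.List.Relation.Unary.All using (_∷_)
open import Data.List.Relation.Unary.AllPairs using (_∷_)
open import Data.List.Relation.Unary.Unique.Propositional using (Unique)
open import Data.List.Membership.Propositional using () renaming (_∈_ to _∈ˡ_)
open import Algebra.Core using (Op₁; Op₂)
open import Algebra.Structures using (IsAbelianGroup)
open import Algebra.Bundles using (AbelianGroup)
open import Relation.Binary.PropositionalEquality using (_≡_; _≢_; refl; sym; trans; cong; cong₂; subst; module ≡-Reasoning)
open import Relation.Nullary using (¬_; yes; no)
open import Relation.Nullary.Decidable using (_×-dec_; ¬?)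
open import Function.Bundles using (Equivalence)

module _ {a} {A : Set a} where

  length≤1 : ∀ {x} {xs : List A} → Unique xs → (∀ {z} → z ∈ˡ xs → z ≡ x) → length xs ≤ 1
  length≤1 {xs = []}        _               _     = z≤n
  length≤1 {xs = _ ∷ []}    _               _     = s≤s z≤n
  length≤1 {xs = _ ∷ _ ∷ _} ((y≢z ∷ _) ∷ _) all≡x =
    ⊥-elim (y≢z (trans (all≡x (here refl)) (sym (all≡x (there (here refl))))))

  length≥2 : ∀ {x y} {xs : List A} → x ∈ˡ xs → y ∈ˡ xs → x ≢ y → 2 ≤ length xs
  length≥2 {xs = _ ∷ []}    (here refl) (here refl) x≢y = ⊥-elim (x≢y refl)
  length≥2 {xs = _ ∷ _ ∷ _} _           _           _   = s≤s (s≤s z≤n)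

∣p∪q∣≤∣p∣+∣q∣ : ∀ {m} (p q : Subset m) → ∣ p ∪ q ∣ ≤ ∣ p ∣ + ∣ q ∣
∣p∪q∣≤∣p∣+∣q∣ Vec.[]             Vec.[]             = z≤n
∣p∪q∣≤∣p∣+∣q∣ (inside Vec.∷ p)  (inside Vec.∷ q)  =
  s≤s (≤-trans (∣p∪q∣≤∣p∣+∣q∣ p q) (+-monoʳ-≤ ∣ p ∣ (n≤1+n ∣ q ∣)))
∣p∪q∣≤∣p∣+∣q∣ (inside Vec.∷ p)  (outside Vec.∷ q) = s≤s (∣p∪q∣≤∣p∣+∣q∣ p q)
∣p∪q∣≤∣p∣+∣q∣ (outside Vec.∷ p) (inside Vec.∷ q)  =
  ≤-trans (s≤s (∣p∪q∣≤∣p∣+∣q∣ p q)) (≤-reflexive (sym (+-suc ∣ p ∣ ∣ q ∣)))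
∣p∪q∣≤∣p∣+∣q∣ (outside Vec.∷ p) (outside Vec.∷ q) = ∣p∪q∣≤∣p∣+∣q∣ p q

module AbelianCayley {n : ℕ} {_∙_ : Op₂ (Fin n)} {ε : Fin n} {_⁻¹ : Op₁ (Fin n)}
                     (isAbelianGroup : IsAbelianGroup _≡_ _∙_ ε _⁻¹) where

  abelianGroup : AbelianGroup _ _
  abelianGroup = record { isAbelianGroup = isAbelianGroup }

  open AbelianGroup abelianGroup using (assoc; comm; identityˡ; identityʳ; inverseˡ; inverseʳ)
  open import Algebra.Properties.AbelianGroup abelianGroup
    using (⁻¹-∙-comm; ∙-cancelˡ; //-rightDividesʳ)
  open import Algebra.Properties.CommutativeSemigroup (AbelianGroup.commutativeSemigroup abelianGroup)
    using (interchange; xy∙z≈xz∙y)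
  open GroupNotions _∙_ ε _⁻¹
  open ≡-Reasoning

  pow-+ : ∀ g i j → pow g (i + j) ≡ pow g i ∙ pow g j
  pow-+ g zero    j = sym (identityˡ _)
  pow-+ g (suc i) j = trans (cong (g ∙_) (pow-+ g i j)) (sym (assoc _ _ _))

  ∙≡ˡ⇒≡ε : ∀ {x y} → x ∙ y ≡ x → y ≡ ε
  ∙≡ˡ⇒≡ε {x} {y} xy≡x = ∙-cancelˡ x y ε (trans xy≡x (sym (identityʳ x)))

  ≡⁻¹⇒∙≡ε : ∀ {x y} → x ≡ y ⁻¹ → x ∙ y ≡ ε
  ≡⁻¹⇒∙≡ε {y = y} refl = inverseˡ y

  quotient-cancel : ∀ p a b → ((p ∙ a) ⁻¹) ∙ (p ∙ b) ≡ (a ⁻¹) ∙ b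
  quotient-cancel p a b = begin
    ((p ∙ a) ⁻¹) ∙ (p ∙ b)       ≡⟨ cong (_∙ (p ∙ b)) (sym (⁻¹-∙-comm p a)) ⟩
    ((p ⁻¹) ∙ (a ⁻¹)) ∙ (p ∙ b)  ≡⟨ interchange _ _ _ _ ⟩
    ((p ⁻¹) ∙ p) ∙ ((a ⁻¹) ∙ b)  ≡⟨ cong (_∙ ((a ⁻¹) ∙ b)) (inverseˡ p) ⟩
    ε ∙ ((a ⁻¹) ∙ b)             ≡⟨ identityˡ _ ⟩
    (a ⁻¹) ∙ b                   ∎

  module Generated (T : Fin n → Set) where

    H : Fin n → Set
    H = ⟨ T ⟩

    ⟨⟩-≡ε : ∀ {x} → x ≡ ε → H x
    ⟨⟩-≡ε refl = one

    ⟨⟩-cancelʳ : ∀ {x y} → H (x ∙ y) → H y → H x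
    ⟨⟩-cancelʳ {x} {y} xy∈H y∈H = subst H (//-rightDividesʳ y x) (mul xy∈H (inv y∈H))

    ⟨⟩-pow-multiple : ∀ {g m} → H (pow g m) → ∀ q → H (pow g (q * m))
    ⟨⟩-pow-multiple         gᵐ∈H zero    = one
    ⟨⟩-pow-multiple {g} {m} gᵐ∈H (suc q) =
      subst H (sym (pow-+ g m (q * m))) (mul gᵐ∈H (⟨⟩-pow-multiple gᵐ∈H q))

    reduce-exponent : ∀ {g x m} .{{_ : NonZero m}} → H (pow g m) →
                      ∃ (λ i → H (pow g i ∙ x)) → ∃ λ r → r < m × H (pow g r ∙ x)
    reduce-exponent {g} {x} {m} gᵐ∈H (i , gⁱx∈H) =
      i % m , m%n<n i m , ⟨⟩-cancelʳ (subst H split-exponent gⁱx∈H) (⟨⟩-pow-multiple gᵐ∈H (i / m))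
      where
        split-exponent : pow g i ∙ x ≡ (pow g (i % m) ∙ x) ∙ pow g (i / m * m)
        split-exponent = begin
          pow g i ∙ x                                ≡⟨ cong (λ e → pow g e ∙ x) (m≡m%n+[m/n]*n i m) ⟩
          pow g (i % m + i / m * m) ∙ x              ≡⟨ cong (_∙ x) (pow-+ g (i % m) (i / m * m)) ⟩
          (pow g (i % m) ∙ pow g (i / m * m)) ∙ x    ≡⟨ xy∙z≈xz∙y _ _ _ ⟩
          (pow g (i % m) ∙ x) ∙ pow g (i / m * m)    ∎

    -- If the m cosets g⁰H, …, gᵐ⁻¹H cover G, every transversal of H has at
    -- most m elements: distinct representatives lie in distinct such cosets.
    index≤ : ∀ {g m k} → (∀ x → ∃ λ r → r < m × H (pow g r ∙ x)) → IndexIs H k → k ≤ m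
    index≤ {g} {m} {k} covered (rep , _ , distinct) = injective⇒≤ {f = exponent} exponent-injective
      where
        exponent : Fin k → Fin m
        exponent a = fromℕ< (proj₁ (proj₂ (covered (rep a))))

        same-coset : ∀ {i j a b} → i ≡ j → H (pow g i ∙ rep a) → H (pow g j ∙ rep b) → a ≡ b
        same-coset {i} {a = a} {b} refl a∈H b∈H =
          distinct a b (subst H (quotient-cancel (pow g i) (rep a) (rep b)) (mul (inv a∈H) b∈H))

        exponent-injective : ∀ {a b} → exponent a ≡ exponent b → a ≡ b
        exponent-injective {a} {b} e with covered (rep a) | covered (rep b)
        ... | i , i<m , a∈H | j , j<m , b∈H = same-coset (fromℕ<-injective i j i<m j<m e) a∈H b∈H

  module CayleyGraph (S : Subset n) where
    open Cayley S

    walk-zero : ∀ {x y} → Walk x y 0 → x ≡ y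
    walk-zero here = refl

    walk-one : ∀ {x y} → Walk x y 1 → Adj x y
    walk-one (step x~y here) = x~y

    adj-from-ε : ∀ {y} → Adj ε y → y ∈ S
    adj-from-ε (t , t∈S , y≡εt) = subst (_∈ S) (sym (trans y≡εt (identityˡ t))) t∈S

    dist-one : ε ∉ S → ∀ {y} → y ∈ S → Dist ε y 1
    dist-one ε∉S {y} y∈S = step (y , y∈S , sym (identityˡ y)) here , shorter
      where
        shorter : ∀ d → d < 1 → ¬ Walk ε y d
        shorter zero    _       w = ε∉S (subst (_∈ S) (sym (walk-zero w)) y∈S)
        shorter (suc _) (s≤s ())

    dist-two : ∀ {x y} → x ≢ ε → x ∉ S → Adj ε y → Adj y x → Dist ε x 2
    dist-two {x} x≢ε x∉S ε~y y~x = step ε~y (step y~x here) , shorter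
      where
        shorter : ∀ d → d < 2 → ¬ Walk ε x d
        shorter zero                _                     w = x≢ε (sym (walk-zero w))
        shorter (suc zero)          _                     w = x∉S (adj-from-ε (walk-one w))
        shorter (suc (suc _))       (s≤s (s≤s ()))

    count≤1 : ∀ {P m x} → CountIs P m → (∀ {z} → P z → z ≡ x) → m ≤ 1
    count≤1 (zs , unique , refl , members) only-x =
      length≤1 unique (λ {z} z∈zs → only-x (Equivalence.to (members z) z∈zs))

    count≥2 : ∀ {P m x y} → CountIs P m → P x → P y → x ≢ y → 2 ≤ m
    count≥2 (zs , _ , refl , members) Px Py x≢y =
      length≥2 (Equivalence.from (members _) Px) (Equivalence.from (members _) Py) x≢y

  module Setting (S : Subset n) (inverse-closed : ∀ x → x ∈ S → (x ⁻¹) ∈ S) (ε∉S : ε ∉ S)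
                 (s : Fin n) (s∈S : s ∈ S) where

    T : Fin n → Set
    T t = (t ∈ S) × (t ≢ s) × (t ≢ (s ⁻¹))

    open Generated T public
    open CayleyGraph S
    open Cayley S

    S-split : ∀ {t} → t ∈ S → t ≡ s ⊎ (t ≡ s ⁻¹ ⊎ T t)
    S-split {t} t∈S with t ≟ s | t ≟ (s ⁻¹)
    ... | yes t≡s | _         = inj₁ t≡s
    ... | no _    | yes t≡s⁻¹ = inj₂ (inj₁ t≡s⁻¹)
    ... | no t≢s  | no t≢s⁻¹  = inj₂ (inj₂ (t∈S , t≢s , t≢s⁻¹))

    -- Step (1).  Multiplying by a generator moves between cosets sⁱH: by an
    -- element of T it stays, by s⁻¹ the exponent grows by one, and by s it
    -- grows by j, because sʲ⁺¹ ∈ H.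
    coset-step : ∀ {j i x t} → H (pow s (suc j)) → H (pow s i ∙ x) → t ∈ S →
                 ∃ λ i′ → H (pow s i′ ∙ (x ∙ t))
    coset-step {j} {i} {x} sʲ⁺¹∈H sⁱx∈H t∈S with S-split t∈S
    ... | inj₁ refl = i + j , subst H (sym times-s) (mul sⁱx∈H sʲ⁺¹∈H)
      where
        times-s : pow s (i + j) ∙ (x ∙ s) ≡ (pow s i ∙ x) ∙ pow s (suc j)
        times-s = begin
          pow s (i + j) ∙ (x ∙ s)            ≡⟨ cong (_∙ (x ∙ s)) (pow-+ s i j) ⟩
          (pow s i ∙ pow s j) ∙ (x ∙ s)      ≡⟨ interchange _ _ _ _ ⟩
          (pow s i ∙ x) ∙ (pow s j ∙ s)      ≡⟨ cong ((pow s i ∙ x) ∙_) (comm _ _) ⟩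
          (pow s i ∙ x) ∙ pow s (suc j)      ∎
    ... | inj₂ (inj₁ refl) = suc i , subst H (sym times-s⁻¹) sⁱx∈H
      where
        times-s⁻¹ : pow s (suc i) ∙ (x ∙ (s ⁻¹)) ≡ pow s i ∙ x
        times-s⁻¹ = begin
          (s ∙ pow s i) ∙ (x ∙ (s ⁻¹))       ≡⟨ cong (_∙ (x ∙ (s ⁻¹))) (comm _ _) ⟩
          (pow s i ∙ s) ∙ (x ∙ (s ⁻¹))       ≡⟨ interchange _ _ _ _ ⟩
          (pow s i ∙ x) ∙ (s ∙ (s ⁻¹))       ≡⟨ cong ((pow s i ∙ x) ∙_) (inverseʳ s) ⟩
          (pow s i ∙ x) ∙ ε                  ≡⟨ identityʳ _ ⟩
          pow s i ∙ x                        ∎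
    ... | inj₂ (inj₂ Tt) = i , subst H (assoc _ _ _) (mul sⁱx∈H (gen Tt))

    coset-walk : ∀ {j x z d} → H (pow s (suc j)) → Walk x z d →
                 ∃ (λ i → H (pow s i ∙ x)) → ∃ λ i → H (pow s i ∙ z)
    coset-walk _      here                      coset = coset
    coset-walk {j} sʲ⁺¹∈H (step (t , t∈S , refl) w) (i , sⁱx∈H) =
      coset-walk {j} sʲ⁺¹∈H w (coset-step {j} {i} sʲ⁺¹∈H sⁱx∈H t∈S)

    index≤order : Connected → ∀ {k} → IndexIs H k → ∀ {i} → 0 < i → H (pow s i) → k ≤ i
    index≤order connected index {suc j} _ sⁱ∈H = index≤ covered index
      where
        covered : ∀ x → ∃ λ r → r < suc j × H (pow s r ∙ x)
        covered x = reduce-exponent sⁱ∈H (coset-walk {j} sⁱ∈H walk (0 , ⟨⟩-≡ε (identityˡ ε)))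
          where
            walk : Walk ε x (proj₁ (connected ε x))
            walk = proj₁ (proj₂ (connected ε x))

    third-generator : 3 ≤ ∣ S ∣ → ∃ T
    third-generator 3≤∣S∣ with any? (λ t → (t ∈? S) ×-dec (¬? (t ≟ s) ×-dec ¬? (t ≟ (s ⁻¹))))
    ... | yes found = found
    ... | no  none  = ⊥-elim (1+n≰n 3≤2)
      where
        S⊆pair : ∀ {x} → x ∈ S → x ∈ (⁅ s ⁆ ∪ ⁅ s ⁻¹ ⁆)
        S⊆pair {x} x∈S with S-split x∈S
        ... | inj₁ refl        = x∈p∪q⁺ (inj₁ (x∈⁅x⁆ s))
        ... | inj₂ (inj₁ refl) = x∈p∪q⁺ (inj₂ (x∈⁅x⁆ (s ⁻¹)))
        ... | inj₂ (inj₂ Tx)   = ⊥-elim (none (x , Tx))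
        3≤2 : 3 ≤ 2
        3≤2 = ≤-trans 3≤∣S∣ (≤-trans (p⊆q⇒∣p∣≤∣q∣ S⊆pair)
          (≤-trans (∣p∪q∣≤∣p∣+∣q∣ ⁅ s ⁆ ⁅ s ⁻¹ ⁆) (≤-reflexive (cong₂ _+_ (∣⁅x⁆∣≡1 s) (∣⁅x⁆∣≡1 (s ⁻¹))))))

    module Obstruction (s∉H : ¬ H s) (s²∉H : ¬ H (s ∙ s)) (s³∉H : ¬ H (s ∙ (s ∙ s)))
                       (s⁴≢ε : s ∙ (s ∙ (s ∙ s)) ≢ ε) where

      ∉S : ∀ {x} → x ≢ s → x ≢ s ⁻¹ → ¬ H x → x ∉ S
      ∉S x≢s x≢s⁻¹ x∉H x∈S with S-split x∈S
      ... | inj₁ x≡s            = x≢s x≡s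
      ... | inj₂ (inj₁ x≡s⁻¹)   = x≢s⁻¹ x≡s⁻¹
      ... | inj₂ (inj₂ Tx)      = x∉H (gen Tx)

      dist-two-outside : ∀ {x y} → ¬ H x → x ≢ s → x ≢ s ⁻¹ → Adj ε y → Adj y x → Dist ε x 2
      dist-two-outside x∉H x≢s x≢s⁻¹ =
        dist-two (λ x≡ε → x∉H (⟨⟩-≡ε x≡ε)) (∉S x≢s x≢s⁻¹ x∉H)

      s≢ε : s ≢ ε
      s≢ε s≡ε = ε∉S (subst (_∈ S) s≡ε s∈S)

      s³-outside : ¬ H ((s ∙ s) ∙ s)
      s³-outside s³∈H = s³∉H (subst H (assoc s s s) s³∈H)

      ε~s : Adj ε s
      ε~s = s , s∈S , sym (identityˡ s)

      s²-at-distance-2 : Dist ε (s ∙ s) 2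
      s²-at-distance-2 = dist-two-outside s²∉H s²≢s s²≢s⁻¹ ε~s (s , s∈S , refl)
        where
          s²≢s : s ∙ s ≢ s
          s²≢s s²≡s = s≢ε (∙≡ˡ⇒≡ε s²≡s)
          s²≢s⁻¹ : s ∙ s ≢ s ⁻¹
          s²≢s⁻¹ s²≡s⁻¹ = s³-outside (⟨⟩-≡ε (≡⁻¹⇒∙≡ε s²≡s⁻¹))

      -- s is the only common neighbour of 1 and s²: a common neighbour is
      -- z = s² w with z, w ∈ S, and every choice other than w = s⁻¹ puts
      -- s², s³ into H or makes s⁴ = 1.
      only-common-neighbour-of-s² : ∀ {z w} → z ∈ S → w ∈ S → z ≡ (s ∙ s) ∙ w → z ≡ s
      only-common-neighbour-of-s² z∈S w∈S z≡s²w with S-split z∈S | S-split w∈S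
      ... | _                 | inj₂ (inj₁ refl) = trans z≡s²w (//-rightDividesʳ s s)
      ... | inj₁ z≡s          | _                = z≡s
      ... | inj₂ (inj₁ z≡s⁻¹) | inj₁ refl        = ⊥-elim (s⁴≢ε s⁴≡ε)
        where
          s⁴≡ε : s ∙ (s ∙ (s ∙ s)) ≡ ε
          s⁴≡ε = begin
            s ∙ (s ∙ (s ∙ s))   ≡⟨ cong (s ∙_) (sym (assoc s s s)) ⟩
            s ∙ ((s ∙ s) ∙ s)   ≡⟨ comm _ _ ⟩
            ((s ∙ s) ∙ s) ∙ s   ≡⟨ ≡⁻¹⇒∙≡ε (trans (sym z≡s²w) z≡s⁻¹) ⟩
            ε                   ∎
      ... | inj₂ (inj₁ z≡s⁻¹) | inj₂ (inj₂ Tw)   = ⊥-elim (s³-outside (⟨⟩-cancelʳ s³w∈H (gen Tw)))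
        where
          s³w∈H : H (((s ∙ s) ∙ s) ∙ _)
          s³w∈H = ⟨⟩-≡ε (trans (sym (xy∙z≈xz∙y _ _ _)) (≡⁻¹⇒∙≡ε (trans (sym z≡s²w) z≡s⁻¹)))
      ... | inj₂ (inj₂ Tz)    | inj₁ refl        = ⊥-elim (s³-outside (subst H z≡s²w (gen Tz)))
      ... | inj₂ (inj₂ Tz)    | inj₂ (inj₂ Tw)   =
        ⊥-elim (s²∉H (⟨⟩-cancelʳ (subst H z≡s²w (gen Tz)) (gen Tw)))

      module WithThirdGenerator {t : Fin n} (Tt : T t) where
        t∈S : t ∈ S
        t∈S = proj₁ Tt

        st∉H : ¬ H (s ∙ t)
        st∉H st∈H = s∉H (⟨⟩-cancelʳ st∈H (gen Tt))

        st-at-distance-2 : Dist ε (s ∙ t) 2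
        st-at-distance-2 = dist-two-outside st∉H st≢s st≢s⁻¹ ε~s (t , t∈S , refl)
          where
            st≢s : s ∙ t ≢ s
            st≢s st≡s = ε∉S (subst (_∈ S) (∙≡ˡ⇒≡ε st≡s) t∈S)
            st≢s⁻¹ : s ∙ t ≢ s ⁻¹
            st≢s⁻¹ st≡s⁻¹ = s²∉H (⟨⟩-cancelʳ (⟨⟩-≡ε s²t≡ε) (gen Tt))
              where
                s²t≡ε : (s ∙ s) ∙ t ≡ ε
                s²t≡ε = trans (xy∙z≈xz∙y s s t) (≡⁻¹⇒∙≡ε st≡s⁻¹)

        s-common : Dist ε s 1 × Adj (s ∙ t) s
        s-common = dist-one ε∉S s∈S , (t ⁻¹ , inverse-closed t t∈S , sym (//-rightDividesʳ t s))

        t-common : Dist ε t 1 × Adj (s ∙ t) t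
        t-common = dist-one ε∉S t∈S ,
          (s ⁻¹ , inverse-closed s s∈S , sym (trans (cong (_∙ (s ⁻¹)) (comm s t)) (//-rightDividesʳ s t)))

      -- c₂ would be both at most 1 (from 1 and s²) and at least 2 (from 1 and st).
      not-distance-regular : ∃ T → ¬ DistanceRegular
      not-distance-regular (t , Tt) (_ , c , _ , _ , c-count , _) =
        1+n≰n (≤-trans (count≥2 (c-count ε (s ∙ t) 1 st-at-distance-2) s-common t-common s≢t)
                       (count≤1 (c-count ε (s ∙ s) 1 s²-at-distance-2) only-s))
        where
          open WithThirdGenerator Tt
          s≢t : s ≢ t
          s≢t s≡t = proj₁ (proj₂ Tt) (sym s≡t)
          only-s : ∀ {z} → Dist ε z 1 × Adj (s ∙ s) z → z ≡ s
          only-s (ε-z , (w , w∈S , z≡s²w)) =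
            only-common-neighbour-of-s² (adj-from-ε (walk-one (proj₁ ε-z))) w∈S z≡s²w

    obstruction : 3 ≤ ∣ S ∣ → DistanceRegular → (∀ i → 0 < i → i < 4 → ¬ H (pow s i)) →
                  pow s 4 ≢ ε → ⊥
    obstruction 3≤∣S∣ dr small-powers-outside s⁴≢ε =
      Obstruction.not-distance-regular
        (λ h → small-powers-outside 1 (s≤s z≤n) (s≤s (s≤s z≤n)) (subst H (sym s¹) h))
        (λ h → small-powers-outside 2 (s≤s z≤n) (s≤s (s≤s (s≤s z≤n))) (subst H (sym s²) h))
        (λ h → small-powers-outside 3 (s≤s z≤n) ≤-refl (subst H (sym s³) h))
        (λ e → s⁴≢ε (trans s⁴ e))
        (third-generator 3≤∣S∣) dr
      where
        s¹ : pow s 1 ≡ s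
        s¹ = identityʳ s
        s² : pow s 2 ≡ s ∙ s
        s² = cong (s ∙_) s¹
        s³ : pow s 3 ≡ s ∙ (s ∙ s)
        s³ = cong (s ∙_) s²
        s⁴ : pow s 4 ≡ s ∙ (s ∙ (s ∙ s))
        s⁴ = cong (s ∙_) s³

proposition3p4 : (n : ℕ) (_∙_ : Op₂ (Fin n)) (ε : Fin n) (_⁻¹ : Op₁ (Fin n)) →
    IsAbelianGroup _≡_ _∙_ ε _⁻¹ →
    (S : Subset n) → (∀ x → x ∈ S → (x ⁻¹) ∈ S) → ε ∉ S → 3 ≤ ∣ S ∣ →
    (s : Fin n) → s ∈ S →
    (∃ λ g → ¬ GroupNotions.⟨_⟩ _∙_ ε _⁻¹ (λ t → (t ∈ S) × (t ≢ s) × (t ≢ (s ⁻¹))) g) →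
    GroupNotions.Cayley.DistanceRegular _∙_ ε _⁻¹ S →
    (k : ℕ) → GroupNotions.IndexIs _∙_ ε _⁻¹ (GroupNotions.⟨_⟩ _∙_ ε _⁻¹ (λ t → (t ∈ S) × (t ≢ s) × (t ≢ (s ⁻¹)))) k →
    (k ≤ 4) × (k ≡ 4 → GroupNotions.HasOrder _∙_ ε _⁻¹ s 4)
proposition3p4 n _∙_ ε _⁻¹ isAG S inverse-closed ε∉S 3≤∣S∣ s s∈S _ dr k index = k≤4 , k≡4⇒order4
  where
    open GroupNotions _∙_ ε _⁻¹ using (pow; HasOrder)
    open AbelianCayley isAG
    open Setting S inverse-closed ε∉S s s∈S

    bound : ∀ {i} → 0 < i → H (pow s i) → k ≤ i
    bound = index≤order (proj₁ dr) index

    small-powers-outside : 4 ≤ k → ∀ i → 0 < i → i < 4 → ¬ H (pow s i)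
    small-powers-outside 4≤k i 0<i i<4 sⁱ∈H = <⇒≱ i<4 (≤-trans 4≤k (bound 0<i sⁱ∈H))

    k≤4 : k ≤ 4
    k≤4 with k ≤? 4
    ... | yes at-most-4 = at-most-4
    ... | no  k≰4 = ⊥-elim (obstruction 3≤∣S∣ dr (small-powers-outside (<⇒≤ (≰⇒> k≰4)))
                                           (λ s⁴≡ε → k≰4 (bound (s≤s z≤n) (⟨⟩-≡ε s⁴≡ε))))

    k≡4⇒order4 : k ≡ 4 → HasOrder s 4
    k≡4⇒order4 refl = s≤s z≤n , s⁴≡ε , λ m 0<m sᵐ≡ε → bound 0<m (⟨⟩-≡ε sᵐ≡ε)
      where
        s⁴≡ε : pow s 4 ≡ ε
        s⁴≡ε with pow s 4 ≟ ε
        ... | yes s⁴≡ε = s⁴≡ε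
        ... | no  s⁴≢ε = ⊥-elim (obstruction 3≤∣S∣ dr (small-powers-outside ≤-refl) s⁴≢ε)
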